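{- Let $\mathcal{F}$ be an $n\times m$ Ferrers diagram with $m\ge n\ge2$. Then the pair $(\mathcal{F},2)$ is MDS-constructible if and only if $|D_i\cap\mathcal{F}|=0$ for all $i>m$ (with $i\le m+n-1$).
   Context: $[i]=\{1,\dots,i\}$. An $n\times m$ Ferrers diagram is a subset $\mathcal{F}\subseteq[n]\times[m]$ such that $(1,1),(n,m)\in\mathcal{F}$; if $(i,j)\in\mathcal{F}$ and $j<m$ then $(i,j+1)\in\mathcal{F}$; and if $(i,j)\in\mathcal{F}$ and $i>1$ then $(i-1,j)\in\mathcal{F}$. Let $c_j=|\{i:(i,j)\in\mathcal{F}\}|$. For $1\le d\le\min\{n,m\}$ and $0\le j\le d-1$ set $\kappa_j(\mathcal{F},d)=\sum_{t=1}^{m-d+1+j}\max\{c_t-j,0\}$ and $\kappa(\mathcal{F},d)=\min_j\kappa_j(\mathcal{F},d)$. For $1\le i\le m+n-1$, $D_i=\{(a,b)\in[n]\times[m]: b-a=m-i\}$. The pair $(\mathcal{F},d)$ is MDS-constructible if $\kappa(\mathcal{F},d)=\sum_{i=1}^{m+n-1}\max\{0,|D_i\cap\mathcal{F}|-d+1\}$. -}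

module Defs where

open import Data.Nat using (ℕ; zero; suc; _+_; _∸_; _≤_; _<_; _⊓_; _≡ᵇ_)
open import Data.Bool using (Bool; true; false; _∧_; if_then_else_)
open import Relation.Binary.PropositionalEquality using (_≡_)
open import Data.Product using (_×_)

-- A subset of [n]×[m] (1-based indices) given by its characteristic function
-- on ℕ × ℕ; entries outside [n]×[m] are required to be false (see IsFerrers).
Diagram : Set
Diagram = ℕ → ℕ → Bool

Σ₁ : ℕ → (ℕ → ℕ) → ℕ
Σ₁ zero    f = 0
Σ₁ (suc k) f = Σ₁ k f + f (suc k)

minUpTo : ℕ → (ℕ → ℕ) → ℕ
minUpTo zero    f = f 0
minUpTo (suc k) f = minUpTo k f ⊓ f (suc k)

record IsFerrers (n m : ℕ) (F : Diagram) : Set where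
  field
    inside  : ∀ i j → F i j ≡ true → (1 ≤ i × i ≤ n) × (1 ≤ j × j ≤ m)
    corner₁ : F 1 1 ≡ true
    corner₂ : F n m ≡ true
    right   : ∀ i j → F i j ≡ true → j < m → F i (suc j) ≡ true
    up      : ∀ i j → F i j ≡ true → 1 < i → F (i ∸ 1) j ≡ true

bit : Bool → ℕ
bit true  = 1
bit false = 0

colCount : ℕ → Diagram → ℕ → ℕ
colCount n F j = Σ₁ n (λ i → bit (F i j))

kappaJ : ℕ → ℕ → Diagram → ℕ → ℕ → ℕ
kappaJ n m F d j = Σ₁ (m ∸ d + 1 + j) (λ t → colCount n F t ∸ j)

-- κ(F,d) = min_{0 ≤ j ≤ d-1} κ_j(F,d)   (used for d ≥ 1)
kappa : ℕ → ℕ → Diagram → ℕ → ℕ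
kappa n m F d = minUpTo (d ∸ 1) (kappaJ n m F d)

-- |D_i ∩ F| where D_i = {(a,b) ∈ [n]×[m] : b - a = m - i},
-- the integer equation b - a = m - i written as b + i = m + a.
diagCount : ℕ → ℕ → Diagram → ℕ → ℕ
diagCount n m F i =
  Σ₁ n (λ a → Σ₁ m (λ b → bit (F a b ∧ ((b + i) ≡ᵇ (m + a)))))

MDSConstructible : ℕ → ℕ → Diagram → ℕ → Set
MDSConstructible n m F d =
  kappa n m F d ≡ Σ₁ (m + n ∸ 1) (λ i → diagCount n m F i ∸ (d ∸ 1))

-- Row 1 of a Ferrers diagram is full, so every column count c_t and every
-- |D_i| with i ≤ m is at least 1.  Hence κ₁(F,2) = Σ_t (c_t − 1) = |F| − m,
-- and κ₀(F,2) = |F| − c_m ≥ |F| − m, so κ(F,2) = |F| − m.  Every cell lies on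
-- exactly one diagonal, so |F| = Σ_i |D_i|, and therefore
--   κ(F,2) − Σ_i max{0, |D_i| − 1} = Σ_{i>m} (|D_i| − max{0, |D_i| − 1}),
-- which vanishes exactly when every D_i with i > m misses F.
module Submission where

open import Defs
open import Data.Nat using (ℕ; _+_; _∸_; _≤_; _<_)
open import Relation.Binary.PropositionalEquality using (_≡_)
open import Function.Bundles using (_⇔_)

open import Data.Nat using (zero; suc; z≤n; s≤s; _≡ᵇ_; _≟_)
open import Data.Nat.Properties
open import Data.Bool using (true; false; _∧_)
open import Data.Bool.Properties using (∧-identityʳ; ∧-zeroʳ)
open import Data.Product using (_×_; _,_; proj₁)
open import Data.Sum using (inj₁; inj₂)
open import Data.Empty using (⊥-elim)
open import Function.Bundles using (mk⇔)
open import Function.Properties.Equivalence using () renaming (trans to ⇔-trans)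
open import Relation.Binary.PropositionalEquality
  using (refl; sym; trans; cong; cong₂; subst; _≢_; ≢-sym; module ≡-Reasoning)
open import Relation.Nullary.Decidable using (dec-true; dec-false)
open import Algebra.Properties.CommutativeSemigroup +-commutativeSemigroup
  using (interchange; xy∙z≈xz∙y)

Σ₁-cong : ∀ N {f g : ℕ → ℕ} → (∀ j → 1 ≤ j → j ≤ N → f j ≡ g j) → Σ₁ N f ≡ Σ₁ N g
Σ₁-cong zero    f≡g = refl
Σ₁-cong (suc N) f≡g =
  cong₂ _+_ (Σ₁-cong N (λ j 1≤j j≤N → f≡g j 1≤j (m≤n⇒m≤1+n j≤N))) (f≡g (suc N) (s≤s z≤n) ≤-refl)

Σ₁-mono-≤ : ∀ N {f g : ℕ → ℕ} → (∀ j → 1 ≤ j → j ≤ N → f j ≤ g j) → Σ₁ N f ≤ Σ₁ N g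
Σ₁-mono-≤ zero    f≤g = z≤n
Σ₁-mono-≤ (suc N) f≤g =
  +-mono-≤ (Σ₁-mono-≤ N (λ j 1≤j j≤N → f≤g j 1≤j (m≤n⇒m≤1+n j≤N))) (f≤g (suc N) (s≤s z≤n) ≤-refl)

Σ₁-zero : ∀ N {f : ℕ → ℕ} → (∀ j → 1 ≤ j → j ≤ N → f j ≡ 0) → Σ₁ N f ≡ 0
Σ₁-zero zero    f≡0 = refl
Σ₁-zero (suc N) f≡0 =
  cong₂ _+_ (Σ₁-zero N (λ j 1≤j j≤N → f≡0 j 1≤j (m≤n⇒m≤1+n j≤N))) (f≡0 (suc N) (s≤s z≤n) ≤-refl)

Σ₁-const-1 : ∀ N → Σ₁ N (λ _ → 1) ≡ N
Σ₁-const-1 zero    = refl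
Σ₁-const-1 (suc N) = trans (cong (_+ 1) (Σ₁-const-1 N)) (+-comm N 1)

Σ₁-distrib-+ : ∀ N (f g : ℕ → ℕ) → Σ₁ N (λ j → f j + g j) ≡ Σ₁ N f + Σ₁ N g
Σ₁-distrib-+ zero    f g = refl
Σ₁-distrib-+ (suc N) f g =
  trans (cong (_+ (f (suc N) + g (suc N))) (Σ₁-distrib-+ N f g))
        (interchange (Σ₁ N f) (Σ₁ N g) (f (suc N)) (g (suc N)))

Σ₁-+ : ∀ p q (f : ℕ → ℕ) → Σ₁ (p + q) f ≡ Σ₁ p f + Σ₁ q (λ j → f (p + j))
Σ₁-+ p zero    f = trans (cong (λ k → Σ₁ k f) (+-identityʳ p)) (sym (+-identityʳ _))
Σ₁-+ p (suc q) f = begin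
  Σ₁ (p + suc q) f                                 ≡⟨ cong (λ k → Σ₁ k f) (+-suc p q) ⟩
  Σ₁ (p + q) f + f (suc (p + q))                   ≡⟨ cong₂ _+_ (Σ₁-+ p q f) (cong f (sym (+-suc p q))) ⟩
  Σ₁ p f + Σ₁ q (λ j → f (p + j)) + f (p + suc q)  ≡⟨ +-assoc (Σ₁ p f) _ _ ⟩
  Σ₁ p f + Σ₁ (suc q) (λ j → f (p + j))            ∎
  where open ≡-Reasoning

Σ₁-comm : ∀ N M (g : ℕ → ℕ → ℕ) → Σ₁ N (λ i → Σ₁ M (g i)) ≡ Σ₁ M (λ j → Σ₁ N (λ i → g i j))
Σ₁-comm zero    M g = sym (Σ₁-zero M (λ _ _ _ → refl))
Σ₁-comm (suc N) M g =
  trans (cong (_+ Σ₁ M (g (suc N))) (Σ₁-comm N M g))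
        (sym (Σ₁-distrib-+ M (λ j → Σ₁ N (λ i → g i j)) (g (suc N))))

term≤Σ₁ : ∀ N (f : ℕ → ℕ) k → 1 ≤ k → k ≤ N → f k ≤ Σ₁ N f
term≤Σ₁ zero    f k 1≤k k≤0 = ⊥-elim (<⇒≱ 1≤k k≤0)
term≤Σ₁ (suc N) f k 1≤k k≤1+N with m≤n⇒m<n∨m≡n k≤1+N
... | inj₁ (s≤s k≤N) = ≤-trans (term≤Σ₁ N f k 1≤k k≤N) (m≤m+n _ _)
... | inj₂ refl      = m≤n+m _ _

Σ₁-single : ∀ N (f : ℕ → ℕ) k → 1 ≤ k → k ≤ N → (∀ i → i ≢ k → f i ≡ 0) → Σ₁ N f ≡ f k
Σ₁-single zero    f k 1≤k k≤0 _ = ⊥-elim (<⇒≱ 1≤k k≤0)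
Σ₁-single (suc N) f k 1≤k k≤1+N others≡0 with m≤n⇒m<n∨m≡n k≤1+N
... | inj₁ (s≤s k≤N) =
  trans (cong₂ _+_ (Σ₁-single N f k 1≤k k≤N others≡0) (others≡0 (suc N) (≢-sym (<⇒≢ (s≤s k≤N)))))
        (+-identityʳ (f k))
... | inj₂ refl =
  cong (_+ f k) (Σ₁-zero N (λ j _ j≤N → others≡0 j (<⇒≢ (s≤s j≤N))))

Σ₁-∸1 : ∀ N (f : ℕ → ℕ) → (∀ j → 1 ≤ j → j ≤ N → 1 ≤ f j) → Σ₁ N (λ j → f j ∸ 1) + N ≡ Σ₁ N f
Σ₁-∸1 N f f≥1 = begin
  Σ₁ N (λ j → f j ∸ 1) + N                  ≡⟨ cong (Σ₁ N (λ j → f j ∸ 1) +_) (sym (Σ₁-const-1 N)) ⟩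
  Σ₁ N (λ j → f j ∸ 1) + Σ₁ N (λ _ → 1)     ≡⟨ sym (Σ₁-distrib-+ N (λ j → f j ∸ 1) (λ _ → 1)) ⟩
  Σ₁ N (λ j → f j ∸ 1 + 1)                  ≡⟨ Σ₁-cong N (λ j 1≤j j≤N → m∸n+n≡m (f≥1 j 1≤j j≤N)) ⟩
  Σ₁ N f                                    ∎
  where open ≡-Reasoning

+-mono-≤-≡⇒≡ : ∀ {a b c d} → a ≤ b → c ≤ d → a + c ≡ b + d → a ≡ b × c ≡ d
+-mono-≤-≡⇒≡ {a} {b} {c} {d} a≤b c≤d a+c≡b+d =
  a≡b , +-cancelˡ-≡ a c d (trans a+c≡b+d (cong (_+ d) (sym a≡b)))
  where
  a≡b : a ≡ b
  a≡b = ≤-antisym a≤b (+-cancelʳ-≤ c b a (≤-trans (+-monoʳ-≤ b c≤d) (≤-reflexive (sym a+c≡b+d))))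

Σ₁-mono-≤-≡⇒≡ : ∀ N {f g : ℕ → ℕ} → (∀ j → f j ≤ g j) → Σ₁ N f ≡ Σ₁ N g →
  ∀ j → 1 ≤ j → j ≤ N → f j ≡ g j
Σ₁-mono-≤-≡⇒≡ zero    f≤g _ j 1≤j j≤0 = ⊥-elim (<⇒≱ 1≤j j≤0)
Σ₁-mono-≤-≡⇒≡ (suc N) f≤g sums≡ j 1≤j j≤1+N
  with +-mono-≤-≡⇒≡ (Σ₁-mono-≤ N (λ j _ _ → f≤g j)) (f≤g (suc N)) sums≡ | m≤n⇒m<n∨m≡n j≤1+N
... | init≡ , _ | inj₁ (s≤s j≤N) = Σ₁-mono-≤-≡⇒≡ N f≤g init≡ j 1≤j j≤N
... | _ , last≡ | inj₂ refl      = last≡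

Σ₁-∸1-≡⇔≡0 : ∀ N (f : ℕ → ℕ) →
  Σ₁ N f ≡ Σ₁ N (λ j → f j ∸ 1) ⇔ (∀ j → 1 ≤ j → j ≤ N → f j ≡ 0)
Σ₁-∸1-≡⇔≡0 N f = mk⇔
  (λ sums≡ j 1≤j j≤N →
     n∸1≡n⇒n≡0 (Σ₁-mono-≤-≡⇒≡ N (λ j → m∸n≤m (f j) 1) (sym sums≡) j 1≤j j≤N))
  (λ f≡0 → Σ₁-cong N (λ j 1≤j j≤N → trans (f≡0 j 1≤j j≤N) (sym (cong (_∸ 1) (f≡0 j 1≤j j≤N)))))
  where
  n∸1≡n⇒n≡0 : ∀ {n} → n ∸ 1 ≡ n → n ≡ 0
  n∸1≡n⇒n≡0 {zero}  _   = refl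
  n∸1≡n⇒n≡0 {suc n} n≡1+n = ⊥-elim (1+n≢n (sym n≡1+n))

Σ₁-+-∸1 : ∀ m n (f : ℕ → ℕ) → 1 ≤ n →
  Σ₁ (m + n ∸ 1) f ≡ Σ₁ m f + Σ₁ (n ∸ 1) (λ j → f (m + j))
Σ₁-+-∸1 m n f 1≤n = trans (cong (λ k → Σ₁ k f) (+-∸-assoc m 1≤n)) (Σ₁-+ m (n ∸ 1) f)

shift-range⇔ : ∀ {m n} (P : ℕ → Set) → 1 ≤ n →
  (∀ j → 1 ≤ j → j ≤ n ∸ 1 → P (m + j)) ⇔ (∀ i → m < i → i ≤ m + n ∸ 1 → P i)
shift-range⇔ {m} {n} P 1≤n = mk⇔
  (λ P-shifted i m<i i≤m+n-1 →
     subst P (m+[n∸m]≡n (<⇒≤ m<i))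
       (P-shifted (i ∸ m) (m<n⇒0<n∸m m<i)
         (≤-trans (∸-monoˡ-≤ m i≤m+n-1) (≤-reflexive (trans (cong (_∸ m) m+n-1≡) (m+n∸m≡n m (n ∸ 1)))))))
  (λ P-range j 1≤j j≤n-1 →
     P-range (m + j) (m<m+n m 1≤j) (≤-trans (+-monoʳ-≤ m j≤n-1) (≤-reflexive (sym m+n-1≡))))
  where
  m+n-1≡ : m + n ∸ 1 ≡ m + (n ∸ 1)
  m+n-1≡ = +-∸-assoc m 1≤n

∧-≡ᵇ-of-≡ : ∀ b {x y} → x ≡ y → (b ∧ (x ≡ᵇ y)) ≡ b
∧-≡ᵇ-of-≡ b {x} {y} x≡y = trans (cong (b ∧_) (dec-true (x ≟ y) x≡y)) (∧-identityʳ b)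

∧-≡ᵇ-of-≢ : ∀ b {x y} → x ≢ y → (b ∧ (x ≡ᵇ y)) ≡ false
∧-≡ᵇ-of-≢ b {x} {y} x≢y = trans (cong (b ∧_) (dec-false (x ≟ y) x≢y)) (∧-zeroʳ b)

bit≤1 : ∀ b → bit b ≤ 1
bit≤1 true  = ≤-refl
bit≤1 false = z≤n

colCount≤ : ∀ n (F : Diagram) j → colCount n F j ≤ n
colCount≤ n F j = ≤-trans (Σ₁-mono-≤ n (λ i _ _ → bit≤1 (F i j))) (≤-reflexive (Σ₁-const-1 n))

cellCount : ℕ → ℕ → Diagram → ℕ
cellCount n m F = Σ₁ m (colCount n F)

-- The diagonal through cell (a,b) has index i = m + a − b, which lies in [1, m + n − 1].
cell-on-one-diagonal : ∀ n m (F : Diagram) {a b} → 1 ≤ a → a ≤ n → 1 ≤ b → b ≤ m →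
  Σ₁ (m + n ∸ 1) (λ i → bit (F a b ∧ ((b + i) ≡ᵇ (m + a)))) ≡ bit (F a b)
cell-on-one-diagonal n m F {a} {b} 1≤a a≤n 1≤b b≤m =
  trans (Σ₁-single (m + n ∸ 1) (λ i → bit (F a b ∧ ((b + i) ≡ᵇ (m + a)))) (m + a ∸ b)
                   (m<n⇒0<n∸m b<m+a) (∸-mono (+-monoʳ-≤ m a≤n) 1≤b) off-diagonal)
        (cong bit (∧-≡ᵇ-of-≡ (F a b) (m+[n∸m]≡n (<⇒≤ b<m+a))))
  where
  b<m+a : b < m + a
  b<m+a = ≤-<-trans b≤m (m<m+n m 1≤a)
  off-diagonal : ∀ i → i ≢ m + a ∸ b → bit (F a b ∧ ((b + i) ≡ᵇ (m + a))) ≡ 0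
  off-diagonal i i≢ = cong bit (∧-≡ᵇ-of-≢ (F a b)
    (λ b+i≡m+a → i≢ (trans (sym (m+n∸m≡n b i)) (cong (_∸ b) b+i≡m+a))))

Σ₁-diagCount : ∀ n m (F : Diagram) → 1 ≤ n → Σ₁ (m + n ∸ 1) (diagCount n m F) ≡ cellCount n m F
Σ₁-diagCount n m F 1≤n = begin
  Σ₁ L (λ i → Σ₁ n (λ a → Σ₁ m (δ i a)))          ≡⟨ Σ₁-comm L n (λ i a → Σ₁ m (δ i a)) ⟩
  Σ₁ n (λ a → Σ₁ L (λ i → Σ₁ m (δ i a)))          ≡⟨ Σ₁-cong n (λ a _ _ → Σ₁-comm L m (λ i → δ i a)) ⟩
  Σ₁ n (λ a → Σ₁ m (λ b → Σ₁ L (λ i → δ i a b)))  ≡⟨ Σ₁-cong n (λ a 1≤a a≤n → Σ₁-cong m (λ b 1≤b b≤m →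
                                                        cell-on-one-diagonal n m F 1≤a a≤n 1≤b b≤m)) ⟩
  Σ₁ n (λ a → Σ₁ m (λ b → bit (F a b)))           ≡⟨ Σ₁-comm n m (λ a b → bit (F a b)) ⟩
  cellCount n m F                                 ∎
  where
  open ≡-Reasoning
  L : ℕ
  L = m + n ∸ 1
  δ : ℕ → ℕ → ℕ → ℕ
  δ i a b = bit (F a b ∧ ((b + i) ≡ᵇ (m + a)))

module _ {n m : ℕ} {F : Diagram} (isF : IsFerrers n m F) where
  open IsFerrers isF

  1≤rows : 1 ≤ n
  1≤rows = proj₁ (proj₁ (inside n m corner₂))

  firstRow-full : ∀ j → 1 ≤ j → j ≤ m → F 1 j ≡ true
  firstRow-full (suc zero)    _ _   = corner₁
  firstRow-full (suc (suc j)) _ j<m = right 1 (suc j) (firstRow-full (suc j) (s≤s z≤n) (<⇒≤ j<m)) j<m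

  colCount-pos : ∀ j → 1 ≤ j → j ≤ m → 1 ≤ colCount n F j
  colCount-pos j 1≤j j≤m = begin
    1               ≡⟨ cong bit (sym (firstRow-full j 1≤j j≤m)) ⟩
    bit (F 1 j)     ≤⟨ term≤Σ₁ n (λ i → bit (F i j)) 1 ≤-refl 1≤rows ⟩
    colCount n F j  ∎
    where open ≤-Reasoning

  -- D_i with i ≤ m contains the first-row cell (1, m − i + 1).
  diagCount-pos : ∀ i → 1 ≤ i → i ≤ m → 1 ≤ diagCount n m F i
  diagCount-pos i 1≤i i≤m = begin
    1                                                  ≡⟨ cong bit (sym on-Dᵢ) ⟩
    bit (F 1 b ∧ ((b + i) ≡ᵇ (m + 1)))                 ≤⟨ term≤Σ₁ m (δ 1) b (s≤s z≤n) b≤m ⟩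
    Σ₁ m (δ 1)                                         ≤⟨ term≤Σ₁ n (λ a → Σ₁ m (δ a)) 1 ≤-refl 1≤rows ⟩
    diagCount n m F i                                  ∎
    where
    open ≤-Reasoning
    δ : ℕ → ℕ → ℕ
    δ a b = bit (F a b ∧ ((b + i) ≡ᵇ (m + a)))
    b : ℕ
    b = suc (m ∸ i)
    b≤m : b ≤ m
    b≤m = subst (_≤ m) (+-∸-assoc 1 i≤m) (∸-monoʳ-≤ (suc m) 1≤i)
    on-Dᵢ : (F 1 b ∧ ((b + i) ≡ᵇ (m + 1))) ≡ true
    on-Dᵢ = trans (∧-≡ᵇ-of-≡ (F 1 b) (trans (cong suc (m∸n+n≡m i≤m)) (+-comm 1 m)))
                  (firstRow-full b (s≤s z≤n) b≤m)

  kappaJ-1 : 2 ≤ m → kappaJ n m F 2 1 + m ≡ cellCount n m F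
  kappaJ-1 2≤m =
    trans (cong (λ k → Σ₁ k (λ t → colCount n F t ∸ 1) + m) (trans (+-assoc (m ∸ 2) 1 1) (m∸n+n≡m 2≤m)))
          (Σ₁-∸1 m (colCount n F) colCount-pos)

  kappaJ-0 : 2 ≤ m → n ≤ m → cellCount n m F ≤ kappaJ n m F 2 0 + m
  kappaJ-0 (s≤s (s≤s {n = r} _)) n≤m = begin
    Σ₁ (suc r) c + c (suc (suc r))  ≤⟨ +-monoʳ-≤ (Σ₁ (suc r) c) (≤-trans (colCount≤ n F _) n≤m) ⟩
    Σ₁ (suc r) c + suc (suc r)      ≡⟨ cong (λ k → Σ₁ k c + suc (suc r)) (sym r+1+0≡1+r) ⟩
    kappaJ n m F 2 0 + suc (suc r)  ∎
    where
    open ≤-Reasoning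
    c : ℕ → ℕ
    c = colCount n F
    r+1+0≡1+r : r + 1 + 0 ≡ suc r
    r+1+0≡1+r = trans (+-identityʳ (r + 1)) (+-comm r 1)

  kappa-2 : 2 ≤ m → n ≤ m → kappa n m F 2 + m ≡ cellCount n m F
  kappa-2 2≤m n≤m = trans (cong (_+ m) (m≥n⇒m⊓n≡n κ₁≤κ₀)) (kappaJ-1 2≤m)
    where
    κ₁≤κ₀ : kappaJ n m F 2 1 ≤ kappaJ n m F 2 0
    κ₁≤κ₀ = +-cancelʳ-≤ m _ _ (≤-trans (≤-reflexive (kappaJ-1 2≤m)) (kappaJ-0 2≤m n≤m))

  kappa-2-split : 2 ≤ m → n ≤ m →
    kappa n m F 2 ≡ Σ₁ m (λ i → diagCount n m F i ∸ 1) + Σ₁ (n ∸ 1) (λ j → diagCount n m F (m + j))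
  kappa-2-split 2≤m n≤m = +-cancelʳ-≡ m _ _ (begin
    kappa n m F 2 + m                ≡⟨ kappa-2 2≤m n≤m ⟩
    cellCount n m F                  ≡⟨ sym (Σ₁-diagCount n m F 1≤rows) ⟩
    Σ₁ (m + n ∸ 1) D                 ≡⟨ Σ₁-+-∸1 m n D 1≤rows ⟩
    Σ₁ m D + tail                    ≡⟨ cong (_+ tail) (sym (Σ₁-∸1 m D diagCount-pos)) ⟩
    head + m + tail                  ≡⟨ xy∙z≈xz∙y head m tail ⟩
    head + tail + m                  ∎)
    where
    open ≡-Reasoning
    D : ℕ → ℕ
    D = diagCount n m F
    head tail : ℕ
    head = Σ₁ m (λ i → D i ∸ 1)
    tail = Σ₁ (n ∸ 1) (λ j → D (m + j))

  MDS-2⇔ : 2 ≤ m → n ≤ m → MDSConstructible n m F 2 ⇔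
    (Σ₁ (n ∸ 1) (λ j → diagCount n m F (m + j)) ≡ Σ₁ (n ∸ 1) (λ j → diagCount n m F (m + j) ∸ 1))
  MDS-2⇔ 2≤m n≤m = mk⇔
    (λ mds → +-cancelˡ-≡ head _ _ (trans (sym (kappa-2-split 2≤m n≤m)) (trans mds rhs≡)))
    (λ tails≡ → trans (kappa-2-split 2≤m n≤m) (trans (cong (head +_) tails≡) (sym rhs≡)))
    where
    D : ℕ → ℕ
    D = diagCount n m F
    head : ℕ
    head = Σ₁ m (λ i → D i ∸ 1)
    rhs≡ : Σ₁ (m + n ∸ 1) (λ i → D i ∸ 1) ≡ head + Σ₁ (n ∸ 1) (λ j → D (m + j) ∸ 1)
    rhs≡ = Σ₁-+-∸1 m n (λ i → D i ∸ 1) 1≤rows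

proposition5p6 : (n m : ℕ) (F : Diagram) → IsFerrers n m F → 2 ≤ n → n ≤ m →
    (MDSConstructible n m F 2 ⇔ (∀ i → m < i → i ≤ m + n ∸ 1 → diagCount n m F i ≡ 0))
proposition5p6 n m F isF 2≤n n≤m =
  ⇔-trans (MDS-2⇔ isF (≤-trans 2≤n n≤m) n≤m)
  (⇔-trans (Σ₁-∸1-≡⇔≡0 (n ∸ 1) (λ j → diagCount n m F (m + j)))
           (shift-range⇔ (λ i → diagCount n m F i ≡ 0) (1≤rows isF)))
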